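{- Let $G$ be a connected graph, let $S$ be the set of simplicial vertices of $G$, and suppose $S\neq\emptyset$ and $\chi_D(G)>\chi_D(G-S)$. Then either $\chi_D(G)\leq \Delta(G)$, or $G$ is a complete multipartite graph having a universal vertex.
   Context: All graphs are finite and simple. A vertex $v$ is simplicial if $N_G(v)$ is a clique, and universal if $N_G[v]=V(G)$. For a proper vertex colouring $c$ of $G$, an automorphism of $(G,c)$ is an automorphism $\varphi$ of $G$ with $c(\varphi(v))=c(v)$ for all $v$; $c$ is distinguishing if the identity is the only such automorphism. The distinguishing chromatic number $\chi_D(G)$ is the minimum number of colours in a proper distinguishing vertex colouring of $G$. $\Delta(G)$ is the maximum degree, and $G-S$ is the subgraph induced by $V(G)\setminus S$. -}

module Defs where

open import Data.Nat using (ℕ; zero; suc; _≤_; _⊔_)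
open import Data.Fin using (Fin)
open import Data.Bool using (Bool; true; false; T; if_then_else_)
open import Data.List using (List; map; foldr; allFin)
open import Data.Nat.ListAction using (sum)
open import Data.Product using (Σ; _×_; _,_; proj₁)
open import Relation.Binary.PropositionalEquality using (_≡_; _≢_)
open import Relation.Nullary using (¬_)
open import Function.Bundles using (_⇔_)

record Graph (n : ℕ) : Set where
  field
    adj     : Fin n → Fin n → Bool
    adj-sym : ∀ x y → adj x y ≡ adj y x
    adj-irr : ∀ x → adj x x ≡ false
open Graph public

Adj : ∀ {n} → Graph n → Fin n → Fin n → Set
Adj G x y = adj G x y ≡ true

data Reach {n} (G : Graph n) : Fin n → Fin n → Set where
  here : ∀ {x} → Reach G x x
  step : ∀ {x y z} → Adj G x y → Reach G y z → Reach G x z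

Connected : ∀ {n} → Graph n → Set
Connected G = ∀ x y → Reach G x y

Simplicial : ∀ {n} → Graph n → Fin n → Set
Simplicial G v = ∀ x y → Adj G v x → Adj G v y → x ≢ y → Adj G x y

Universal : ∀ {n} → Graph n → Fin n → Set
Universal G v = ∀ x → x ≢ v → Adj G v x

-- degree and maximum degree (Δ = 0 for the empty graph)
degree : ∀ {n} → Graph n → Fin n → ℕ
degree {n} G v = sum (map (λ u → if adj G v u then 1 else 0) (allFin n))

maxDegree : ∀ {n} → Graph n → ℕ
maxDegree {n} G = foldr _⊔_ 0 (map (degree G) (allFin n))

CompleteMultipartite : ∀ {n} → Graph n → Set
CompleteMultipartite {n} G =
  Σ (Fin n → Fin n) λ part → ∀ x y → (Adj G x y ⇔ part x ≢ part y)

-- Colourings / automorphisms for a general adjacency relation on a vertex type V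
-- (needed so that induced subgraphs G - S can be handled directly).

record Automorphism (V : Set) (a : V → V → Bool) : Set where
  field
    fun     : V → V
    inv     : V → V
    inv-l   : ∀ x → inv (fun x) ≡ x
    inv-r   : ∀ x → fun (inv x) ≡ x
    pres    : ∀ x y → a (fun x) (fun y) ≡ a x y
open Automorphism public

record DistColouring (V : Set) (a : V → V → Bool) (k : ℕ) : Set where
  field
    col    : V → Fin k
    proper : ∀ x y → a x y ≡ true → col x ≢ col y
    disting : (φ : Automorphism V a) → (∀ x → col (fun φ x) ≡ col x) →
              ∀ x → fun φ x ≡ x

IsChiD : (V : Set) (a : V → V → Bool) → ℕ → Set
IsChiD V a k = DistColouring V a k × (∀ j → DistColouring V a j → k ≤ j)

SubV : ∀ {n} → (Fin n → Bool) → Set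
SubV {n} keep = Σ (Fin n) (λ v → T (keep v))

subAdj : ∀ {n} (G : Graph n) (keep : Fin n → Bool) → SubV keep → SubV keep → Bool
subAdj G keep (u , _) (v , _) = adj G u v

module Submission where

-- Let S be the set of simplicial vertices. Adjacent simplicial vertices have the
-- same neighbours in G − S, and automorphisms map S onto itself. Call s ∈ S exposed
-- when some neighbour u ∉ S of s has a neighbour outside the cluster of s: the
-- neighbours of s in G − S together with the simplicial vertices that have the same
-- neighbours in G − S as s.
--
-- If every s ∈ S is exposed, a distinguishing colouring of G − S extends greedily, in
-- index order, to one of G with max(χ_D(G − S), Δ) colours: s only has to avoid the
-- colours of its neighbours in G − S and of its earlier twins, which lie with s in
-- N[u] but miss the outside neighbour of u, so fewer than deg u ≤ Δ colours are
-- forbidden. Since χ_D(G − S) < χ_D(G), this gives χ_D(G) ≤ Δ.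
--
-- Otherwise connectivity makes the cluster of an unexposed s the whole graph, which
-- yields a universal vertex, so Δ = n − 1. Whenever x ≁ y, y ≁ w and x ∼ w, giving y
-- the colour of x and all other vertices their own colour is distinguishing with
-- n − 1 colours (w tells x from y). Hence if χ_D(G) > Δ, non-adjacency is an
-- equivalence relation and G is complete multipartite.

open import Defs

open import Level using (Level; 0ℓ)
open import Data.Bool as Bool using (Bool; true; false; T; not; if_then_else_)
open import Data.Bool.Properties using (T?; T-irrelevant; T-≡; ⇔→≡; not-¬; ¬-not)
open import Data.Nat as ℕ using (ℕ; zero; suc; _≤_; _<_; _⊔_; z≤n; s≤s; s≤s⁻¹; s<s⁻¹)
open import Data.Nat.Properties as ℕ
  using (m≤n⇒m≤1+n; m≤n⇒m<n∨m≡n; m≤m⊔n; m≤n⊔m; ≤-trans; <⇒≱; module ≤-Reasoning)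
open import Data.Nat.ListAction using (sum)
open import Data.Fin as Fin using (Fin; zero; suc; _≟_; toℕ; fromℕ<; punchOut; inject≤)
open import Data.Fin.Properties as Fin
  using (any?; all?; ¬∀⟶∃¬; pigeonhole; toℕ<n; <⇒≢; suc-injective; punchOut-injective; inject≤-injective)
open import Data.List using (List; _∷_; tabulate; length; filter; map; allFin; lookup; foldr)
open import Data.List.Properties using (length-map; map-tabulate)
open import Data.List.Membership.Propositional using (_∈_; _∉_)
open import Data.List.Membership.Propositional.Properties using (∈-map⁺; ∈-filter⁺; ∈-allFin)
open import Data.List.Relation.Unary.Any using (here; there; index)
open import Data.List.Relation.Unary.Any.Properties using (lookup-index)
open import Data.Product using (Σ; ∃; _×_; _,_; proj₁; proj₂)
open import Data.Sum using (_⊎_; inj₁; inj₂; [_,_])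
open import Function using (_∘_; _∘₂_; id)
open import Function.Bundles using (_⇔_; mk⇔; Equivalence)
open import Relation.Binary using (Rel; IsDecEquivalence)
open import Relation.Binary.Definitions using (tri<; tri≈; tri>)
import Relation.Binary.Construct.On as On
open import Relation.Binary.PropositionalEquality
  using (_≡_; _≢_; refl; sym; trans; cong; cong₂; subst; subst₂; module ≡-Reasoning)
open import Relation.Nullary
  using (Dec; yes; no; does; ¬_; ¬?; contradiction; _×-dec_; _⊎-dec_; _→-dec_)
import Relation.Nullary.Decidable as Dec
open import Relation.Nullary.Decidable using (decidable-stable)
open import Relation.Unary using (Pred; Decidable; _⊆_; _∪_; ｛_｝)
open import Relation.Unary.Properties using (_∪?_)

private
  variable
    ℓ : Level
    n : ℕ

count : {P : Pred (Fin n) ℓ} → Decidable P → ℕ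
count P? = sum (tabulate (λ x → if does (P? x) then 1 else 0))

count-mono : {P Q : Pred (Fin n) ℓ} (P? : Decidable P) (Q? : Decidable Q) →
             P ⊆ Q → count P? ≤ count Q?
count-mono {n = zero}  P? Q? P⊆Q = z≤n
count-mono {n = suc n} P? Q? P⊆Q with P? zero | Q? zero
... | yes p | no ¬q = contradiction (P⊆Q p) ¬q
... | yes _ | yes _ = s≤s (count-mono (P? ∘ suc) (Q? ∘ suc) P⊆Q)
... | no _  | yes _ = m≤n⇒m≤1+n (count-mono (P? ∘ suc) (Q? ∘ suc) P⊆Q)
... | no _  | no _  = count-mono (P? ∘ suc) (Q? ∘ suc) P⊆Q

count-insert : {P : Pred (Fin n) ℓ} (P? : Decidable P) {a : Fin n} → ¬ P a →
               count ((a ≟_) ∪? P?) ≡ suc (count P?)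
count-insert {n = suc n} P? {zero} ¬Pa with P? zero
... | yes Pa = contradiction Pa ¬Pa
... | no _ = refl
count-insert {n = suc n} P? {suc a} ¬Pa with P? zero
... | yes _ = cong suc (count-insert (P? ∘ suc) ¬Pa)
... | no _ = count-insert (P? ∘ suc) ¬Pa

count-< : {P Q : Pred (Fin n) ℓ} (P? : Decidable P) (Q? : Decidable Q) {a : Fin n} →
          P ⊆ Q → Q a → ¬ P a → count P? < count Q?
count-< P? Q? {a} P⊆Q Qa ¬Pa = subst (_≤ count Q?) (count-insert P? ¬Pa)
  (count-mono ((a ≟_) ∪? P?) Q? [ (λ { refl → Qa }) , P⊆Q ])

count-full : {P : Pred (Fin n) ℓ} (P? : Decidable P) → (∀ x → P x) → count P? ≡ n
count-full {n = zero}  P? all = refl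
count-full {n = suc n} P? all with P? zero
... | yes _ = cong suc (count-full (P? ∘ suc) (all ∘ suc))
... | no ¬P0 = contradiction (all zero) ¬P0

length-filter-tabulate : ∀ {a} {A : Set a} {P : Pred A ℓ} (P? : Decidable P) (g : Fin n → A) →
                         length (filter P? (tabulate g)) ≡ count (P? ∘ g)
length-filter-tabulate {n = zero}  P? g = refl
length-filter-tabulate {n = suc n} P? g with does (P? (g zero))
... | true  = cong suc (length-filter-tabulate P? (g ∘ suc))
... | false = length-filter-tabulate P? (g ∘ suc)

module _ {k : ℕ} where
  open import Data.List.Membership.DecPropositional (_≟_ {k}) using (_∈?_)

  length<⇒∃∉ : (L : List (Fin k)) → length L < k → ∃ (_∉ L)
  length<⇒∃∉ L |L|<k = ¬∀⟶∃¬ k (_∈ L) (_∈? L) ¬covered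
    where
    ¬covered : ¬ (∀ c → c ∈ L)
    ¬covered c∈L with pigeonhole |L|<k (index ∘ c∈L)
    ... | i , j , i<j , same = <⇒≢ i<j (begin
      i                          ≡⟨ lookup-index (c∈L i) ⟩
      lookup L (index (c∈L i))   ≡⟨ cong (lookup L) same ⟩
      lookup L (index (c∈L j))   ≡⟨ lookup-index (c∈L j) ⟨
      j                          ∎)
      where open ≡-Reasoning

  free-colour : (c : Fin n → Fin k) {P : Pred (Fin n) ℓ} (P? : Decidable P) →
                count P? < k → ∃ λ κ → ∀ {x} → P x → c x ≢ κ
  free-colour {n = n} c P? few =
    κ , λ {x} Px cx≡κ → κ∉L (subst (_∈ L) cx≡κ (∈-map⁺ c (∈-filter⁺ P? (∈-allFin x) Px)))
    where
    L = map c (filter P? (allFin n))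
    |L|≡count : length L ≡ count P?
    |L|≡count = trans (length-map c (filter P? (allFin n))) (length-filter-tabulate P? id)
    free = length<⇒∃∉ L (subst (_< k) (sym |L|≡count) few)
    κ = proj₁ free
    κ∉L = proj₂ free

-- Greedy extension of a partial colouring

module Greedy {n k : ℕ} (fixed : Fin n → Bool) (fixedColour : ∀ x → T (fixed x) → Fin k)
  {Conflict : Fin n → Pred (Fin n) ℓ} (Conflict? : ∀ s → Decidable (Conflict s))
  (conflict-earlier : ∀ {s x} → ¬ T (fixed s) → Conflict s x → T (fixed x) ⊎ x Fin.< s)
  (few-conflicts : ∀ {s} → ¬ T (fixed s) → count (Conflict? s) < k) where

  -- Until its own stage an unfixed vertex carries a placeholder colour; k > 0 by few-conflicts.
  initial : Fin n → Fin k
  initial x with T? (fixed x)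
  ... | yes f = fixedColour x f
  ... | no ¬f = fromℕ< (few-conflicts ¬f)

  stage : ℕ → Fin n → Fin k
  stage zero = initial
  stage (suc i) x with T? (fixed x) | toℕ x ℕ.≟ i
  ... | no ¬f | yes _ = proj₁ (free-colour (stage i) (Conflict? x) (few-conflicts ¬f))
  ... | _     | _     = stage i x

  stage-unchanged : ∀ {x i} → T (fixed x) ⊎ toℕ x ≢ i → stage (suc i) x ≡ stage i x
  stage-unchanged {x} {i} idle with T? (fixed x) | toℕ x ℕ.≟ i
  ... | yes _ | _       = refl
  ... | no _  | no _    = refl
  ... | no ¬f | yes x≡i = contradiction idle [ ¬f , (λ x≢i → x≢i x≡i) ]

  stage-fixed : ∀ {x} → T (fixed x) → ∀ i → stage i x ≡ initial x
  stage-fixed f zero    = refl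
  stage-fixed f (suc i) = trans (stage-unchanged (inj₁ f)) (stage-fixed f i)

  stage-settled : ∀ {x j} → toℕ x < j → stage j x ≡ stage (suc (toℕ x)) x
  stage-settled {x} {suc j} x<1+j with m≤n⇒m<n∨m≡n (s≤s⁻¹ x<1+j)
  ... | inj₁ x<j  = trans (stage-unchanged (inj₂ (ℕ.<⇒≢ x<j))) (stage-settled x<j)
  ... | inj₂ refl = refl

  stage-on-turn : ∀ {s x} → ¬ T (fixed s) → Conflict s x →
                  stage (toℕ s) x ≢ stage (suc (toℕ s)) s
  stage-on-turn {s} ¬f c with T? (fixed s) | toℕ s ℕ.≟ toℕ s
  ... | yes f  | _        = contradiction f ¬f
  ... | no _   | no s≢s   = contradiction refl s≢s
  ... | no ¬f′ | yes _    = proj₂ (free-colour (stage (toℕ s)) (Conflict? s) (few-conflicts ¬f′)) c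

  colour : Fin n → Fin k
  colour = stage n

  colour-fixed : ∀ {x} (f : T (fixed x)) → colour x ≡ fixedColour x f
  colour-fixed {x} f = trans (stage-fixed f n) initial-fixed
    where
    initial-fixed : initial x ≡ fixedColour x f
    initial-fixed with T? (fixed x)
    ... | yes f′ = cong (fixedColour x) (T-irrelevant f′ f)
    ... | no ¬f  = contradiction f ¬f

  colour-conflict : ∀ {s x} → ¬ T (fixed s) → Conflict s x → colour x ≢ colour s
  colour-conflict {s} {x} ¬f c = subst₂ _≢_
    (settled-before (conflict-earlier ¬f c)) (sym (stage-settled (toℕ<n s))) (stage-on-turn ¬f c)
    where
    settled-before : T (fixed x) ⊎ x Fin.< s → stage (toℕ s) x ≡ colour x
    settled-before (inj₁ f)   = trans (stage-fixed f (toℕ s)) (sym (stage-fixed f n))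
    settled-before (inj₂ x<s) = trans (stage-settled x<s) (sym (stage-settled (toℕ<n x)))

module _ (G : Graph n) where

  Adj? : ∀ x y → Dec (Adj G x y)
  Adj? x y = Dec.map T-≡ (T? (adj G x y))

  Adj-sym : ∀ {x y} → Adj G x y → Adj G y x
  Adj-sym {x} {y} xy = trans (adj-sym G y x) xy

  Adj-irrefl : ∀ {x y} → Adj G x y → x ≢ y
  Adj-irrefl {x} xx refl with trans (sym xx) (adj-irr G x)
  ... | ()

  degree≡count : ∀ v → degree G v ≡ count (Adj? v)
  degree≡count v = cong sum (map-tabulate {n = n} id (λ u → if adj G v u then 1 else 0))

  degree≤maxDegree : ∀ v → degree G v ≤ maxDegree G
  degree≤maxDegree v = ≤-foldr-⊔ (∈-map⁺ (degree G) (∈-allFin v))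
    where
    ≤-foldr-⊔ : ∀ {x xs} → x ∈ xs → x ≤ foldr _⊔_ 0 xs
    ≤-foldr-⊔ (here refl)                 = m≤m⊔n _ _
    ≤-foldr-⊔ {xs = y ∷ _} (there x∈xs) = ≤-trans (≤-foldr-⊔ x∈xs) (m≤n⊔m y _)

  universal⇒n≤1+Δ : ∀ {z} → Universal G z → n ≤ suc (maxDegree G)
  universal⇒n≤1+Δ {z} univ = begin
    n                           ≡⟨ count-full ((z ≟_) ∪? Adj? z) z-or-neighbour ⟨
    count ((z ≟_) ∪? Adj? z)    ≡⟨ count-insert (Adj? z) (λ zz → Adj-irrefl zz refl) ⟩
    suc (count (Adj? z))        ≡⟨ cong suc (degree≡count z) ⟨
    suc (degree G z)            ≤⟨ s≤s (degree≤maxDegree z) ⟩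
    suc (maxDegree G)           ∎
    where
    open ≤-Reasoning
    z-or-neighbour : ∀ x → z ≡ x ⊎ Adj G z x
    z-or-neighbour x with z ≟ x
    ... | yes z≡x = inj₁ z≡x
    ... | no z≢x  = inj₂ (univ x (z≢x ∘ sym))

  Reach-closed : {X : Pred (Fin n) ℓ} → (∀ {a b} → X a → Adj G a b → X b) →
                 ∀ {x y} → X x → Reach G x y → X y
  Reach-closed closed Xx here          = Xx
  Reach-closed closed Xx (step xy reach) = Reach-closed closed (closed Xx xy) reach

  neighbours-simplicial⇒universal : Connected G → ∀ {v} →
    (∀ {a} → Adj G v a → Simplicial G a) → Universal G v
  neighbours-simplicial⇒universal connected {v} simplicial x x≢v =
    [ (λ v≡x → contradiction (sym v≡x) x≢v) , id ] (Reach-closed closed (inj₁ refl) (connected v x))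
    where
    closed : ∀ {a b} → v ≡ a ⊎ Adj G v a → Adj G a b → v ≡ b ⊎ Adj G v b
    closed (inj₁ refl) vb = inj₂ vb
    closed {a} {b} (inj₂ va) ab with v ≟ b
    ... | yes v≡b = inj₁ v≡b
    ... | no v≢b  = inj₂ (simplicial va v b (Adj-sym va) ab v≢b)

  adjacent-simplicial-twins : ∀ {a b} → Simplicial G a → Simplicial G b → Adj G a b →
                              ∀ {y} → y ≢ a → y ≢ b → adj G a y ≡ adj G b y
  adjacent-simplicial-twins sa sb ab y≢a y≢b = ⇔→≡ (mk⇔
    (λ ay → sa _ _ ab ay (y≢b ∘ sym))
    (λ by → sb _ _ (Adj-sym ab) by (y≢a ∘ sym)))

_⁻¹ : ∀ {V a} → Automorphism V a → Automorphism V a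
_⁻¹ {a = a} φ = record
  { fun = inv φ ; inv = fun φ ; inv-l = inv-r φ ; inv-r = inv-l φ
  ; pres = λ x y → trans (sym (pres φ (inv φ x) (inv φ y))) (cong₂ a (inv-r φ x) (inv-r φ y))
  }

module _ (G : Graph n) (φ : Automorphism (Fin n) (adj G)) where

  fun-injective : ∀ {x y} → fun φ x ≡ fun φ y → x ≡ y
  fun-injective {x} {y} eq = trans (sym (inv-l φ x)) (trans (cong (inv φ) eq) (inv-l φ y))

  simplicial-reflected : ∀ {v} → Simplicial G (fun φ v) → Simplicial G v
  simplicial-reflected {v} simplicial a b va vb a≢b = trans (sym (pres φ a b))
    (simplicial (fun φ a) (fun φ b) (trans (pres φ v a) va) (trans (pres φ v b) vb) (a≢b ∘ fun-injective))

simplicial-preserved : (G : Graph n) (φ : Automorphism (Fin n) (adj G)) →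
                       ∀ {v} → Simplicial G v → Simplicial G (fun φ v)
simplicial-preserved G φ {v} simplicial =
  simplicial-reflected G (φ ⁻¹) (subst (Simplicial G) (sym (inv-l φ v)) simplicial)

module _ (G : Graph n) (keep : Fin n → Bool) where

  SubV-≡ : ∀ {x y} {kx : T (keep x)} {ky : T (keep y)} → x ≡ y → _≡_ {A = SubV keep} (x , kx) (y , ky)
  SubV-≡ refl = cong (_ ,_) (T-irrelevant _ _)

  restrict : (φ : Automorphism (Fin n) (adj G)) → (∀ x → keep (fun φ x) ≡ keep x) →
             Automorphism (SubV keep) (subAdj G keep)
  restrict φ invariant = record
    { fun   = λ (x , kx) → fun φ x , subst T (sym (invariant x)) kx
    ; inv   = λ (x , kx) → inv φ x , subst T (sym (inv-invariant x)) kx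
    ; inv-l = λ (x , _) → SubV-≡ (inv-l φ x)
    ; inv-r = λ (x , _) → SubV-≡ (inv-r φ x)
    ; pres  = λ (x , _) (y , _) → pres φ x y
    }
    where
    inv-invariant : ∀ x → keep (inv φ x) ≡ keep x
    inv-invariant x = trans (sym (invariant (inv φ x))) (cong keep (inv-r φ x))

-- Complete multipartite graphs

equivalence-kernel : {R : Rel (Fin n) ℓ} → IsDecEquivalence R →
                     Σ (Fin n → Fin n) λ f → ∀ x y → R x y ⇔ f x ≡ f y
equivalence-kernel {n = zero}  _ = (λ ()) , λ ()
equivalence-kernel {n = suc n} {R = R} isDecEquivalence = f , kernel
  where
  module R = IsDecEquivalence isDecEquivalence
  rest = equivalence-kernel (On.isDecEquivalence suc isDecEquivalence)

  f : Fin (suc n) → Fin (suc n)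
  f zero = zero
  f (suc x) with zero R.≟ suc x
  ... | yes _ = zero
  ... | no _  = suc (proj₁ rest x)

  kernel : ∀ x y → R x y ⇔ f x ≡ f y
  kernel zero zero = mk⇔ (λ _ → refl) (λ _ → R.refl)
  kernel zero (suc y) with zero R.≟ suc y
  ... | yes r = mk⇔ (λ _ → refl) (λ _ → r)
  ... | no ¬r = mk⇔ (λ r → contradiction r ¬r) λ ()
  kernel (suc x) zero with zero R.≟ suc x
  ... | yes r = mk⇔ (λ _ → refl) (λ _ → R.sym r)
  ... | no ¬r = mk⇔ (λ r → contradiction (R.sym r) ¬r) λ ()
  kernel (suc x) (suc y) with zero R.≟ suc x | zero R.≟ suc y
  ... | yes rx | yes ry = mk⇔ (λ _ → refl) (λ _ → R.trans (R.sym rx) ry)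
  ... | yes rx | no ¬ry = mk⇔ (λ r → contradiction (R.trans rx r) ¬ry) λ ()
  ... | no ¬rx | yes ry = mk⇔ (λ r → contradiction (R.trans ry (R.sym r)) ¬rx) λ ()
  ... | no _   | no _   = mk⇔ (cong suc ∘ Equivalence.to (proj₂ rest x y))
                              (Equivalence.from (proj₂ rest x y) ∘ suc-injective)

nonadjacency-transitive⇒complete-multipartite : (G : Graph n) →
  (∀ {x y z} → adj G x y ≡ false → adj G y z ≡ false → adj G x z ≡ false) →
  CompleteMultipartite G
nonadjacency-transitive⇒complete-multipartite G nonadjacent-trans = part , λ x y → mk⇔
  (λ xy same → not-¬ xy (Equivalence.from (kernel x y) same))
  (λ different → ¬-not (different ∘ Equivalence.to (kernel x y)))
  where
  nonadjacency : IsDecEquivalence (λ x y → adj G x y ≡ false)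
  nonadjacency = record
    { isEquivalence = record
      { refl  = adj-irr G _
      ; sym   = λ {x} {y} x≁y → trans (adj-sym G y x) x≁y
      ; trans = nonadjacent-trans
      }
    ; _≟_ = λ x y → adj G x y Bool.≟ false
    }
  part = proj₁ (equivalence-kernel nonadjacency)
  kernel = proj₂ (equivalence-kernel nonadjacency)

module _ {m} (G : Graph (suc m)) {x y w : Fin (suc m)}
         (x≁y : adj G x y ≡ false) (y≁w : adj G y w ≡ false) (x∼w : Adj G x w) where

  private
    x≢y : x ≢ y
    x≢y refl = not-¬ x∼w y≁w

    merge : Fin (suc m) → Fin (suc m)
    merge v with v ≟ y
    ... | yes _ = x
    ... | no _  = v

    y≢merge : ∀ v → y ≢ merge v
    y≢merge v with v ≟ y
    ... | yes _   = x≢y ∘ sym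
    ... | no v≢y  = v≢y ∘ sym

    colour : Fin (suc m) → Fin m
    colour v = punchOut (y≢merge v)

    same-colour : ∀ a b → colour a ≡ colour b → a ≡ b ⊎ (a ≡ x × b ≡ y) ⊎ (a ≡ y × b ≡ x)
    same-colour a b eq with a ≟ y | b ≟ y | punchOut-injective (y≢merge a) (y≢merge b) eq
    ... | yes a≡y | yes b≡y | _    = inj₁ (trans a≡y (sym b≡y))
    ... | yes a≡y | no _    | x≡b  = inj₂ (inj₂ (a≡y , sym x≡b))
    ... | no _    | yes b≡y | a≡x  = inj₂ (inj₁ (a≡x , b≡y))
    ... | no _    | no _    | a≡b  = inj₁ a≡b

    proper : ∀ a b → adj G a b ≡ true → colour a ≢ colour b
    proper a b ab eq with same-colour a b eq
    ... | inj₁ refl                 = Adj-irrefl G ab refl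
    ... | inj₂ (inj₁ (refl , refl)) = not-¬ ab x≁y
    ... | inj₂ (inj₂ (refl , refl)) = not-¬ ab (trans (adj-sym G y x) x≁y)

    module _ (φ : Automorphism (Fin (suc m)) (adj G)) (same : ∀ v → colour (fun φ v) ≡ colour v) where
      fixes-w : fun φ w ≡ w
      fixes-w with same-colour _ _ (same w)
      ... | inj₁ φw≡w              = φw≡w
      ... | inj₂ (inj₁ (_ , refl)) = contradiction x≁y (not-¬ x∼w)
      ... | inj₂ (inj₂ (_ , refl)) = contradiction refl (Adj-irrefl G x∼w)

      fixes-x : fun φ x ≡ x
      fixes-x with same-colour _ _ (same x)
      ... | inj₁ φx≡x              = φx≡x
      ... | inj₂ (inj₁ (_ , x≡y))  = contradiction x≡y x≢y
      ... | inj₂ (inj₂ (φx≡y , _)) = contradiction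
              (subst₂ (λ a b → adj G a b ≡ false) (sym φx≡y) (sym fixes-w) y≁w)
              (not-¬ (trans (pres φ x w) x∼w))

      fixes : ∀ v → fun φ v ≡ v
      fixes v with same-colour _ _ (same v)
      ... | inj₁ φv≡v               = φv≡v
      ... | inj₂ (inj₁ (φv≡x , refl)) =
        contradiction (fun-injective G φ (trans φv≡x (sym fixes-x))) (x≢y ∘ sym)
      ... | inj₂ (inj₂ (_ , refl))    = fixes-x

  K₁∪K₂-colouring : DistColouring (Fin (suc m)) (adj G) m
  K₁∪K₂-colouring = record { col = colour ; proper = proper ; disting = fixes }

K₁∪K₂⇒χD<n : (G : Graph n) {x y w : Fin n} →
  adj G x y ≡ false → adj G y w ≡ false → Adj G x w →
  ∀ {χ} → (∀ k → DistColouring (Fin n) (adj G) k → χ ≤ k) → χ < n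
K₁∪K₂⇒χD<n {n = zero}  G {x = ()}
K₁∪K₂⇒χD<n {n = suc m} G x≁y y≁w x∼w minimal = s≤s (minimal m (K₁∪K₂-colouring G x≁y y≁w x∼w))

universal⇒complete-multipartite : (G : Graph n) {z : Fin n} → Universal G z → ∀ {χ} →
  (∀ k → DistColouring (Fin n) (adj G) k → χ ≤ k) → maxDegree G < χ → CompleteMultipartite G
universal⇒complete-multipartite G universal minimal Δ<χ =
  nonadjacency-transitive⇒complete-multipartite G nonadjacent-trans
  where
  nonadjacent-trans : ∀ {x y w} → adj G x y ≡ false → adj G y w ≡ false → adj G x w ≡ false
  nonadjacent-trans {x} {y} {w} x≁y y≁w with adj G x w in x∼w
  ... | false = refl
  ... | true  = contradiction (≤-trans (universal⇒n≤1+Δ G universal) Δ<χ)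
                              (<⇒≱ (K₁∪K₂⇒χD<n G x≁y y≁w x∼w minimal))

-- Removing the simplicial vertices

T-not⇔¬T : ∀ {b} → T (not b) ⇔ (¬ T b)
T-not⇔¬T {false} = mk⇔ (λ _ ()) (λ _ → _)
T-not⇔¬T {true}  = mk⇔ (λ ()) (λ ¬t → ¬t _)

¬T-injective : ∀ {a b} → (¬ T a) ⇔ (¬ T b) → a ≡ b
¬T-injective {false} {false} _ = refl
¬T-injective {false} {true}  e = contradiction _ (Equivalence.to e (λ ()))
¬T-injective {true}  {false} e = contradiction _ (Equivalence.from e (λ ()))
¬T-injective {true}  {true}  _ = refl

module SimplicialRemoval (G : Graph n) (keep : Fin n → Bool)
  (removed⇔simplicial : ∀ v → T (not (keep v)) ⇔ Simplicial G v) where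

  removed⇒simplicial : ∀ {v} → ¬ T (keep v) → Simplicial G v
  removed⇒simplicial {v} = Equivalence.to (removed⇔simplicial v) ∘ Equivalence.from T-not⇔¬T

  simplicial⇒removed : ∀ {v} → Simplicial G v → ¬ T (keep v)
  simplicial⇒removed {v} = Equivalence.to T-not⇔¬T ∘ Equivalence.from (removed⇔simplicial v)

  keep-invariant : (φ : Automorphism (Fin n) (adj G)) → ∀ x → keep (fun φ x) ≡ keep x
  keep-invariant φ x = ¬T-injective (mk⇔
    (simplicial⇒removed ∘ simplicial-reflected G φ ∘ removed⇒simplicial)
    (simplicial⇒removed ∘ simplicial-preserved G φ ∘ removed⇒simplicial))

  Twin : Fin n → Fin n → Set
  Twin x s = ∀ y → T (keep y) → adj G x y ≡ adj G s y

  Twin? : ∀ x s → Dec (Twin x s)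
  Twin? x s = all? (λ y → T? (keep y) →-dec adj G x y Bool.≟ adj G s y)

  adjacent-removed-twins : ∀ {a b} → ¬ T (keep a) → ¬ T (keep b) → Adj G a b → Twin a b
  adjacent-removed-twins ¬ka ¬kb ab y ky = adjacent-simplicial-twins G
    (removed⇒simplicial ¬ka) (removed⇒simplicial ¬kb) ab (λ { refl → ¬ka ky }) (λ { refl → ¬kb ky })

  Cluster : Fin n → Pred (Fin n) 0ℓ
  Cluster s x = (T (keep x) × Adj G s x) ⊎ (¬ T (keep x) × Twin x s)

  Cluster? : ∀ s → Decidable (Cluster s)
  Cluster? s x = (T? (keep x) ×-dec Adj? G s x) ⊎-dec (¬? (T? (keep x)) ×-dec Twin? x s)

  Conflict : Fin n → Pred (Fin n) 0ℓ
  Conflict s x = Cluster s x × (T (keep x) ⊎ x Fin.< s)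

  Conflict? : ∀ s → Decidable (Conflict s)
  Conflict? s x = Cluster? s x ×-dec (T? (keep x) ⊎-dec x Fin.<? s)

  Exposed : Fin n → Set
  Exposed s = ∃ λ u → ∃ λ w → T (keep u) × Adj G s u × Adj G u w × ¬ Cluster s w

  Exposed? : ∀ s → Dec (Exposed s)
  Exposed? s = any? λ u → any? λ w →
    T? (keep u) ×-dec Adj? G s u ×-dec Adj? G u w ×-dec ¬? (Cluster? s w)

  cluster-self : ∀ {s} → ¬ T (keep s) → Cluster s s
  cluster-self ¬ks = inj₂ (¬ks , λ _ _ → refl)

  cluster⊆closed-neighbourhood : ∀ {s u} → ¬ T (keep s) → T (keep u) → Adj G s u →
                                 Cluster s ⊆ ｛ u ｝ ∪ Adj G u
  cluster⊆closed-neighbourhood {u = u} ¬ks ku su {x} (inj₁ (_ , sx)) with u ≟ x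
  ... | yes u≡x = inj₁ u≡x
  ... | no u≢x  = inj₂ (removed⇒simplicial ¬ks u x su sx u≢x)
  cluster⊆closed-neighbourhood ¬ks ku su (inj₂ (_ , twin)) = inj₂ (Adj-sym G (trans (twin _ ku) su))

  exposed⇒conflicts<Δ : ∀ {s} → ¬ T (keep s) → Exposed s → count (Conflict? s) < maxDegree G
  exposed⇒conflicts<Δ {s} ¬ks (u , w , ku , su , uw , w∉cluster) =
    ≤-trans (s<s⁻¹ (begin-strict
      suc (count (Conflict? s))       ≡⟨ count-insert (Conflict? s) (s≮s ∘ proj₂) ⟨
      count ((s ≟_) ∪? Conflict? s)   <⟨ count-< ((s ≟_) ∪? Conflict? s) ((u ≟_) ∪? Adj? G u)
                                                 s∪conflicts⊆N[u] (inj₂ uw) w∉ ⟩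
      count ((u ≟_) ∪? Adj? G u)      ≡⟨ count-insert (Adj? G u) (λ uu → Adj-irrefl G uu refl) ⟩
      suc (count (Adj? G u))          ≡⟨ cong suc (degree≡count G u) ⟨
      suc (degree G u)                ∎))
    (degree≤maxDegree G u)
    where
    open ≤-Reasoning
    s≮s : ¬ (T (keep s) ⊎ s Fin.< s)
    s≮s = [ ¬ks , ℕ.<-irrefl refl ]
    s∪conflicts⊆N[u] : ｛ s ｝ ∪ Conflict s ⊆ ｛ u ｝ ∪ Adj G u
    s∪conflicts⊆N[u] (inj₁ refl) = inj₂ (Adj-sym G su)
    s∪conflicts⊆N[u] (inj₂ c)    = cluster⊆closed-neighbourhood ¬ks ku su (proj₁ c)
    w∉ : ¬ (s ≡ w ⊎ Conflict s w)
    w∉ (inj₁ refl) = w∉cluster (cluster-self ¬ks)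
    w∉ (inj₂ c)    = w∉cluster (proj₁ c)

  cluster-closed : ∀ {s} → ¬ Exposed s → ∀ {a b} → Cluster s a → Adj G a b → Cluster s b
  cluster-closed {s} unexposed {a} {b} (inj₁ (ka , sa)) ab with Cluster? s b
  ... | yes b∈cluster = b∈cluster
  ... | no b∉cluster  = contradiction (a , b , ka , sa , ab , b∉cluster) unexposed
  cluster-closed unexposed {b = b} (inj₂ (¬ka , twin)) ab with T? (keep b)
  ... | yes kb  = inj₁ (kb , trans (sym (twin b kb)) ab)
  ... | no ¬kb = inj₂ (¬kb , λ y ky → trans (sym (adjacent-removed-twins ¬ka ¬kb ab y ky)) (twin y ky))

  unexposed⇒universal : Connected G → ∀ {s} → ¬ T (keep s) → ¬ Exposed s → ∃ (Universal G)
  unexposed⇒universal connected {s} ¬ks unexposed with any? (λ u → T? (keep u) ×-dec Adj? G s u)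
  ... | yes (u , ku , su) = u , λ x x≢u →
    [ (λ u≡x → contradiction (sym u≡x) x≢u) , id ]
      (cluster⊆closed-neighbourhood ¬ks ku su
        (Reach-closed G (cluster-closed unexposed) (cluster-self ¬ks) (connected s x)))
  ... | no ∄u = s , neighbours-simplicial⇒universal G connected
                      (λ {a} sa → removed⇒simplicial (λ ka → ∄u (a , ka , sa)))

  exposed-or-universal : Connected G → (∀ {s} → ¬ T (keep s) → Exposed s) ⊎ ∃ (Universal G)
  exposed-or-universal connected with any? (λ s → ¬? (T? (keep s)) ×-dec ¬? (Exposed? s))
  ... | yes (s , ¬ks , unexposed) = inj₂ (unexposed⇒universal connected ¬ks unexposed)
  ... | no ∄unexposed = inj₁ λ {s} ¬ks →
    decidable-stable (Exposed? s) (λ unexposed → ∄unexposed (s , ¬ks , unexposed))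

  module _ {k} (c₀ : DistColouring (SubV keep) (subAdj G keep) k)
           (exposed : ∀ {s} → ¬ T (keep s) → Exposed s) where

    private
      module c₀ = DistColouring c₀

      k≤k⊔Δ : k ≤ k ⊔ maxDegree G
      k≤k⊔Δ = m≤m⊔n k (maxDegree G)

      open Greedy keep (λ x kx → inject≤ (c₀.col (x , kx)) k≤k⊔Δ) Conflict? (λ _ → proj₂)
        (λ ¬ks → ≤-trans (exposed⇒conflicts<Δ ¬ks (exposed ¬ks)) (m≤n⊔m k (maxDegree G)))

      same-c₀-colour : ∀ {a b} (ka : T (keep a)) (kb : T (keep b)) →
                       colour a ≡ colour b → c₀.col (a , ka) ≡ c₀.col (b , kb)
      same-c₀-colour ka kb eq = inject≤-injective k≤k⊔Δ k≤k⊔Δ _ _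
        (trans (sym (colour-fixed ka)) (trans eq (colour-fixed kb)))

      twins-apart : ∀ {a b} → ¬ T (keep a) → ¬ T (keep b) → Twin a b → a ≢ b → colour a ≢ colour b
      twins-apart {a} {b} ¬ka ¬kb twin a≢b with Fin.<-cmp a b
      ... | tri< a<b _ _ = colour-conflict ¬kb (inj₂ (¬ka , twin) , inj₂ a<b)
      ... | tri≈ _ a≡b _ = contradiction a≡b a≢b
      ... | tri> _ _ b<a = colour-conflict ¬ka (inj₂ (¬kb , sym ∘₂ twin) , inj₂ b<a) ∘ sym

      proper : ∀ a b → adj G a b ≡ true → colour a ≢ colour b
      proper a b ab with T? (keep a) | T? (keep b)
      ... | yes ka | yes kb  = c₀.proper (a , ka) (b , kb) ab ∘ same-c₀-colour ka kb
      ... | yes ka | no ¬kb  = colour-conflict ¬kb (inj₁ (ka , Adj-sym G ab) , inj₁ ka)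
      ... | no ¬ka | yes kb  = colour-conflict ¬ka (inj₁ (kb , ab) , inj₁ kb) ∘ sym
      ... | no ¬ka | no ¬kb  = twins-apart ¬ka ¬kb (adjacent-removed-twins ¬ka ¬kb ab) (Adj-irrefl G ab)

      module _ (φ : Automorphism (Fin n) (adj G)) (same : ∀ x → colour (fun φ x) ≡ colour x) where
        fixes-kept : ∀ {x} → T (keep x) → fun φ x ≡ x
        fixes-kept {x} kx = cong proj₁ (c₀.disting (restrict G keep φ (keep-invariant φ))
          (λ (y , ky) → same-c₀-colour _ ky (same y)) (x , kx))

        fixes : ∀ x → fun φ x ≡ x
        fixes x with T? (keep x) | fun φ x ≟ x
        ... | yes kx | _        = fixes-kept kx
        ... | no _   | yes φx≡x = φx≡x
        ... | no ¬kx | no φx≢x  = contradiction (same x) (twins-apart ¬kφx ¬kx twin φx≢x)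
          where
          ¬kφx : ¬ T (keep (fun φ x))
          ¬kφx = subst (¬_ ∘ T) (sym (keep-invariant φ x)) ¬kx
          twin : Twin (fun φ x) x
          twin y ky = trans (cong (adj G (fun φ x)) (sym (fixes-kept ky))) (pres φ x y)

    extend : DistColouring (Fin n) (adj G) (k ⊔ maxDegree G)
    extend = record { col = colour ; proper = proper ; disting = fixes }

open SimplicialRemoval using (exposed-or-universal; extend)

mainTheorem2 : ∀ {n} (G : Graph n) → Connected G →
    (keep : Fin n → Bool) → (∀ v → (T (not (keep v)) ⇔ Simplicial G v)) →
    (∃ λ v → Simplicial G v) →
    (χG χGS : ℕ) → IsChiD (Fin n) (adj G) χG → IsChiD (SubV keep) (subAdj G keep) χGS →
    χGS < χG →
    χG ≤ maxDegree G ⊎ (CompleteMultipartite G × (∃ λ v → Universal G v))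
mainTheorem2 G connected keep removed⇔simplicial _ χG χGS (_ , minimal) (cGS , _) χGS<χG
  with χG ℕ.≤? maxDegree G | exposed-or-universal G keep removed⇔simplicial connected
... | yes χG≤Δ | _               = inj₁ χG≤Δ
... | no χG≰Δ  | inj₂ universal  =
  inj₂ (universal⇒complete-multipartite G (proj₂ universal) minimal (ℕ.≰⇒> χG≰Δ) , universal)
... | no χG≰Δ  | inj₁ exposed    = contradiction
  (minimal _ (extend G keep removed⇔simplicial cGS exposed))
  (<⇒≱ (ℕ.⊔-lub χGS<χG (ℕ.≰⇒> χG≰Δ)))
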